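{- Let $\iota\colon\mathbf{A}\to\mathbf{B}$ be an isomorphism of commutative bimonoids and let $e_A\colon\mathbf{A}\hookrightarrow\mathbf{A}^{\Delta}$ and $e_B\colon\mathbf{B}\hookrightarrow\mathbf{B}^{\Delta}$ be commutative complemented Dedekind--MacNeille completions of $\mathbf{A}$ and $\mathbf{B}$. Then there is a unique isomorphism $\iota^{\Delta}\colon\mathbf{A}^{\Delta}\to\mathbf{B}^{\Delta}$ extending $\iota$, i.e.\ with $\iota^{\Delta}\circ e_A=e_B\circ\iota$.
   Context: A bimonoid $\langle A,\leq,\cdot,1,+,0\rangle$ is a poset with two monoid structures ($\cdot$ with unit $1$, $+$ with unit $0$), both operations order preserving in each argument, satisfying hemidistributivity $x\cdot(y+z)\leq(x\cdot y)+z$ and $(z+y)\cdot x\leq z+(y\cdot x)$; commutative if both operations are commutative. Homomorphisms preserve order, $\cdot,1,+,0$; embeddings are homomorphisms that are order embeddings. In a commutative bimonoid, $y$ is a complement of $x$ if $x\cdot y\leq 0$ and $1\leq x+y$; it is unique when it exists, written $\overline{x}$; the bimonoid is complemented if every element has a complement and complete if its order is a complete lattice. An embedding $e\colon\mathbf{A}\hookrightarrow\mathbf{C}$ of commutative bimonoids is a commutative $\Delta_1$-extension if the elements $e(a)\cdot\overline{e(b)}$ ($a,b\in\mathbf{A}$, complement existing in $\mathbf{C}$) are join dense in $\mathbf{C}$ and the elements $e(a)+\overline{e(b)}$ are meet dense in $\mathbf{C}$. A commutative complemented Dedekind--MacNeille completion of $\mathbf{A}$ is a commutative $\Delta_1$-extension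 $e\colon\mathbf{A}\hookrightarrow\mathbf{C}$ with $\mathbf{C}$ complete and complemented. -}

module Defs where

open import Data.Product using (Σ; ∃; ∃-syntax; _×_; _,_)
open import Relation.Binary.PropositionalEquality using (_≡_)
open import Relation.Binary.Structures using (IsPartialOrder)

record CommBimonoid : Set₁ where
  infixl 7 _·_
  infixl 6 _+_
  infix 4 _≤_
  field
    Carrier : Set
    _≤_     : Carrier → Carrier → Set
    _·_     : Carrier → Carrier → Carrier
    one     : Carrier
    _+_     : Carrier → Carrier → Carrier
    zero    : Carrier
    isPartialOrder : IsPartialOrder _≡_ _≤_
    ·-assoc : ∀ x y z → (x · y) · z ≡ x · (y · z)
    ·-identityˡ : ∀ x → one · x ≡ x
    ·-identityʳ : ∀ x → x · one ≡ x
    +-assoc : ∀ x y z → (x + y) + z ≡ x + (y + z)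
    +-identityˡ : ∀ x → zero + x ≡ x
    +-identityʳ : ∀ x → x + zero ≡ x
    ·-mono : ∀ {x x' y y'} → x ≤ x' → y ≤ y' → x · y ≤ x' · y'
    +-mono : ∀ {x x' y y'} → x ≤ x' → y ≤ y' → x + y ≤ x' + y'
    hemidistribˡ : ∀ x y z → x · (y + z) ≤ (x · y) + z
    hemidistribʳ : ∀ x y z → (z + y) · x ≤ z + (y · x)
    ·-comm : ∀ x y → x · y ≡ y · x
    +-comm : ∀ x y → x + y ≡ y + x

module _ (C : CommBimonoid) where
  open CommBimonoid C

  IsComplement : Carrier → Carrier → Set
  IsComplement x y = (x · y ≤ zero) × (one ≤ x + y)

  Complemented : Set
  Complemented = ∀ x → ∃[ y ] IsComplement x y

  IsUpperBound : (Carrier → Set) → Carrier → Set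
  IsUpperBound P u = ∀ y → P y → y ≤ u

  IsLowerBound : (Carrier → Set) → Carrier → Set
  IsLowerBound P l = ∀ y → P y → l ≤ y

  IsJoin : (Carrier → Set) → Carrier → Set
  IsJoin P x = IsUpperBound P x × (∀ u → IsUpperBound P u → x ≤ u)

  IsMeet : (Carrier → Set) → Carrier → Set
  IsMeet P x = IsLowerBound P x × (∀ l → IsLowerBound P l → l ≤ x)

  Complete : Set₁
  Complete = ∀ (P : Carrier → Set) → ∃[ x ] IsJoin P x

  JoinDense : (Carrier → Set) → Set
  JoinDense D = ∀ x → IsJoin (λ y → D y × y ≤ x) x

  MeetDense : (Carrier → Set) → Set
  MeetDense D = ∀ x → IsMeet (λ y → D y × x ≤ y) x

module _ (A B : CommBimonoid) where
  private
    module A = CommBimonoid A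
    module B = CommBimonoid B

  IsHom : (A.Carrier → B.Carrier) → Set
  IsHom f = (∀ {x y} → x A.≤ y → f x B.≤ f y)
          × (∀ x y → f (x A.· y) ≡ f x B.· f y)
          × (f A.one ≡ B.one)
          × (∀ x y → f (x A.+ y) ≡ f x B.+ f y)
          × (f A.zero ≡ B.zero)

  IsEmbedding : (A.Carrier → B.Carrier) → Set
  IsEmbedding f = IsHom f × (∀ {x y} → f x B.≤ f y → x A.≤ y)

  IsIso : (A.Carrier → B.Carrier) → Set
  IsIso f = IsHom f × Σ (B.Carrier → A.Carrier) λ g →
              (∀ x → g (f x) ≡ x) × (∀ y → f (g y) ≡ y)
              × (∀ {x y} → x B.≤ y → g x A.≤ g y)

  IsΔ₁Extension : (A.Carrier → B.Carrier) → Set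
  IsΔ₁Extension e =
    IsEmbedding e
    × JoinDense B (λ c → ∃[ a ] ∃[ b ] ∃[ d ] IsComplement B (e b) d × c ≡ e a B.· d)
    × MeetDense B (λ c → ∃[ a ] ∃[ b ] ∃[ d ] IsComplement B (e b) d × c ≡ e a B.+ d)

  IsComplementedDMCompletion : (A.Carrier → B.Carrier) → Set₁
  IsComplementedDMCompletion e =
    IsΔ₁Extension e × Complete B × Complemented B

{-# OPTIONS --safe #-}
module Submission where

-- Both completions are generated by the elements e(a)·ē(b) (join densely) and e(a)+ē(b)
-- (meet densely), and the order between two such generators is decided inside A:
-- e(a)·ē(b) ≤ e(p)+ē(q) iff a·q ≤ p+b, by the residuation x·w ≤ z ⟺ x ≤ z+w̄.
-- Hence φ(x) := ⋁ { e₂(a)·ē₂(b) | e₁(a)·ē₁(b) ≤ x } satisfies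
-- x ≤ e₁(p)+ē₁(q) ⟺ φ(x) ≤ e₂(p)+ē₂(q); as every element is determined by these tests,
-- φ is an order isomorphism extending the identity of A, and residuation reduces the
-- preservation of · and + to the same tests.  Any embedding extending the identity passes
-- the same tests, so it equals φ.  Finally e_B ∘ ι is again such a completion of A.

open import Defs
open import Data.Product using (Σ; _×_; _,_; proj₁; proj₂; ∃-syntax)
open import Function.Base using (_∘_)
open import Function.Bundles using (_⇔_; mk⇔; module Equivalence)
open import Function.Properties.Equivalence using (⇔-setoid) renaming (sym to ⇔-sym; trans to ⇔-trans)
open import Level using (0ℓ)
open import Relation.Binary.Bundles using (Poset)
open import Relation.Binary.PropositionalEquality
  using (_≡_; refl; sym; trans; cong; cong₂; subst; subst₂; module ≡-Reasoning)
open import Relation.Binary.Structures using (IsPartialOrder)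
import Relation.Binary.Reasoning.PartialOrder as PosetReasoning
import Relation.Binary.Reasoning.Setoid as SetoidReasoning

open Equivalence using (to; from)

module ⇔-Reasoning = SetoidReasoning (⇔-setoid 0ℓ)

interchange : {X : Set} (_∙_ : X → X → X)
            → (∀ x y z → (x ∙ y) ∙ z ≡ x ∙ (y ∙ z)) → (∀ x y → x ∙ y ≡ y ∙ x)
            → ∀ a b c d → (a ∙ b) ∙ (c ∙ d) ≡ (a ∙ c) ∙ (b ∙ d)
interchange _∙_ assoc comm a b c d = begin
  (a ∙ b) ∙ (c ∙ d)   ≡⟨ assoc a b (c ∙ d) ⟩
  a ∙ (b ∙ (c ∙ d))   ≡⟨ cong (a ∙_) (assoc b c d) ⟨
  a ∙ ((b ∙ c) ∙ d)   ≡⟨ cong (λ t → a ∙ (t ∙ d)) (comm b c) ⟩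
  a ∙ ((c ∙ b) ∙ d)   ≡⟨ cong (a ∙_) (assoc c b d) ⟩
  a ∙ (c ∙ (b ∙ d))   ≡⟨ assoc a c (b ∙ d) ⟨
  (a ∙ c) ∙ (b ∙ d)   ∎
  where open ≡-Reasoning

module Properties (C : CommBimonoid) where
  open CommBimonoid C
  open IsPartialOrder isPartialOrder public
    using (antisym) renaming (refl to ≤-refl; trans to ≤-trans; reflexive to ≤-reflexive)

  poset : Poset 0ℓ 0ℓ 0ℓ
  poset = record { Carrier = Carrier ; _≈_ = _≡_ ; _≤_ = _≤_ ; isPartialOrder = isPartialOrder }

  module ≤-Reasoning = PosetReasoning poset

  IsComplement-sym : ∀ {x y} → IsComplement C x y → IsComplement C y x
  IsComplement-sym {x} {y} (xy≤0 , 1≤x+y) =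
    subst (_≤ zero) (·-comm x y) xy≤0 , subst (one ≤_) (+-comm x y) 1≤x+y

  residuation : ∀ {w w' x z} → IsComplement C w w' → (x · w ≤ z ⇔ x ≤ z + w')
  residuation {w} {w'} {x} {z} (ww'≤0 , 1≤w+w') = mk⇔ shift unshift
    where
    open ≤-Reasoning
    shift : x · w ≤ z → x ≤ z + w'
    shift xw≤z = begin
      x              ≡⟨ ·-identityʳ x ⟨
      x · one        ≤⟨ ·-mono ≤-refl 1≤w+w' ⟩
      x · (w + w')   ≤⟨ hemidistribˡ x w w' ⟩
      x · w + w'     ≤⟨ +-mono xw≤z ≤-refl ⟩
      z + w'         ∎
    unshift : x ≤ z + w' → x · w ≤ z
    unshift x≤z+w' = begin
      x · w          ≤⟨ ·-mono x≤z+w' ≤-refl ⟩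
      (z + w') · w   ≤⟨ hemidistribʳ w w' z ⟩
      z + w' · w     ≤⟨ +-mono ≤-refl (subst (_≤ zero) (·-comm w w') ww'≤0) ⟩
      z + zero       ≡⟨ +-identityʳ z ⟩
      z              ∎

  complement-unique : ∀ {x y y'} → IsComplement C x y → IsComplement C x y' → y ≡ y'
  complement-unique c c' = antisym (below c c') (below c' c)
    where
    below : ∀ {x y y'} → IsComplement C x y → IsComplement C x y' → y ≤ y'
    below {x} {y} {y'} c c' = subst (y ≤_) (+-identityˡ y')
      (to (residuation c') (subst (_≤ zero) (·-comm x y) (proj₁ c)))

  complement-+ : ∀ {x x' y y'} → IsComplement C x x' → IsComplement C y y'
               → IsComplement C (x + y) (x' · y')
  complement-+ {x} {x'} {y} {y'} cx cy = product≤0 , 1≤sum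
    where
    open ≤-Reasoning
    product≤0 : (x + y) · (x' · y') ≤ zero
    product≤0 = subst (_≤ zero) (·-assoc (x + y) x' y')
      (from (residuation (IsComplement-sym cy))
        (subst ((x + y) · x' ≤_) (sym (+-identityˡ y))
          (from (residuation (IsComplement-sym cx)) (≤-reflexive (+-comm x y)))))
    1≤sum : one ≤ (x + y) + x' · y'
    1≤sum = begin
      one                  ≤⟨ proj₂ cx ⟩
      x + x'               ≤⟨ +-mono ≤-refl (to (residuation (IsComplement-sym cy)) ≤-refl) ⟩
      x + (x' · y' + y)    ≡⟨ cong (x +_) (+-comm (x' · y') y) ⟩
      x + (y + x' · y')    ≡⟨ +-assoc x y (x' · y') ⟨
      (x + y) + x' · y'    ∎

  complement-· : ∀ {x x' y y'} → IsComplement C x x' → IsComplement C y y'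
               → IsComplement C (x · y) (x' + y')
  complement-· cx cy = IsComplement-sym (complement-+ (IsComplement-sym cx) (IsComplement-sym cy))

  ·-interchange : ∀ a b c d → (a · b) · (c · d) ≡ (a · c) · (b · d)
  ·-interchange = interchange _·_ ·-assoc ·-comm

  ·-swapʳ : ∀ x y z → (x · y) · z ≡ (x · z) · y
  ·-swapʳ x y z = trans (·-assoc x y z) (trans (cong (x ·_) (·-comm y z)) (sym (·-assoc x z y)))

  +-interchange : ∀ a b c d → (a + b) + (c + d) ≡ (a + c) + (b + d)
  +-interchange = interchange _+_ +-assoc +-comm

  JoinDense-⊆ : ∀ {D D' : Carrier → Set} → (∀ {x} → D x → D' x) → JoinDense C D → JoinDense C D'
  JoinDense-⊆ D⊆D' dense x = (λ _ → proj₂) , λ u ub → proj₂ (dense x) u λ y (Dy , y≤x) → ub y (D⊆D' Dy , y≤x)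

  MeetDense-⊆ : ∀ {D D' : Carrier → Set} → (∀ {x} → D x → D' x) → MeetDense C D → MeetDense C D'
  MeetDense-⊆ D⊆D' dense x = (λ _ → proj₂) , λ l lb → proj₂ (dense x) l λ y (Dy , x≤y) → lb y (D⊆D' Dy , x≤y)

module _ {A B : CommBimonoid} {f : CommBimonoid.Carrier A → CommBimonoid.Carrier B} where
  private
    module A = CommBimonoid A
    module B = CommBimonoid B

  IsEmbedding-≤⇔ : IsEmbedding A B f → ∀ {x y} → f x B.≤ f y ⇔ x A.≤ y
  IsEmbedding-≤⇔ ((mono , _) , reflect) = mk⇔ reflect mono

  IsIso⇒IsEmbedding : IsIso A B f → IsEmbedding A B f
  IsIso⇒IsEmbedding (hom , g , g∘f , _ , g-mono) = hom , λ {x} {y} fx≤fy →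
    subst₂ A._≤_ (g∘f x) (g∘f y) (g-mono fx≤fy)

IsEmbedding-∘ : ∀ {A B C : CommBimonoid}
                  {f : CommBimonoid.Carrier A → CommBimonoid.Carrier B}
                  {g : CommBimonoid.Carrier B → CommBimonoid.Carrier C}
              → IsEmbedding A B f → IsEmbedding B C g → IsEmbedding A C (g ∘ f)
IsEmbedding-∘ {f = f} {g} ((f-mono , f-· , f-one , f-+ , f-zero) , f-reflect)
                          ((g-mono , g-· , g-one , g-+ , g-zero) , g-reflect) =
  ( g-mono ∘ f-mono
  , (λ x y → trans (cong g (f-· x y)) (g-· (f x) (f y)))
  , trans (cong g f-one) g-one
  , (λ x y → trans (cong g (f-+ x y)) (g-+ (f x) (f y)))
  , trans (cong g f-zero) g-zero )
  , f-reflect ∘ g-reflect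

IsΔ₁Extension-∘-iso : ∀ {A B C : CommBimonoid}
                        {ι : CommBimonoid.Carrier A → CommBimonoid.Carrier B}
                        {e : CommBimonoid.Carrier B → CommBimonoid.Carrier C}
                    → IsIso A B ι → IsΔ₁Extension B C e → IsΔ₁Extension A C (e ∘ ι)
IsΔ₁Extension-∘-iso {A} {B} {C} {ι} {e} ι-iso@(_ , ι⁻¹ , _ , ι∘ι⁻¹ , _) (e-emb , joinDense , meetDense) =
  IsEmbedding-∘ {A} {B} {C} {ι} {e} (IsIso⇒IsEmbedding {A} {B} ι-iso) e-emb ,
  JoinDense-⊆ (reindex _·_) joinDense ,
  MeetDense-⊆ (reindex _+_) meetDense
  where
  open CommBimonoid C using (Carrier; _·_; _+_)
  open Properties C
  reindex : (_∙_ : Carrier → Carrier → Carrier)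
          → ∀ {x} → ∃[ a ] ∃[ b ] ∃[ d ] IsComplement C (e b) d × x ≡ e a ∙ d
          → ∃[ a ] ∃[ b ] ∃[ d ] IsComplement C (e (ι b)) d × x ≡ e (ι a) ∙ d
  reindex _∙_ (a , b , d , complement , x≡) =
    ι⁻¹ a , ι⁻¹ b , d ,
    subst (λ t → IsComplement C (e t) d) (sym (ι∘ι⁻¹ b)) complement ,
    trans x≡ (cong (λ t → e t ∙ d) (sym (ι∘ι⁻¹ a)))

module Completion (A C : CommBimonoid) (e : CommBimonoid.Carrier A → CommBimonoid.Carrier C)
                  (ext : IsΔ₁Extension A C e) (complemented : Complemented C) where
  private module A = CommBimonoid A
  open CommBimonoid C public
  open Properties C public

  compl : Carrier → Carrier
  compl x = proj₁ (complemented x)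

  compl-isComplement : ∀ x → IsComplement C x (compl x)
  compl-isComplement x = proj₂ (complemented x)

  private
    e-emb : IsEmbedding A C e
    e-emb = proj₁ ext
    e-hom : IsHom A C e
    e-hom = proj₁ e-emb

  e-· : ∀ a b → e (a A.· b) ≡ e a · e b
  e-· = proj₁ (proj₂ e-hom)

  e-one : e A.one ≡ one
  e-one = proj₁ (proj₂ (proj₂ e-hom))

  e-+ : ∀ a b → e (a A.+ b) ≡ e a + e b
  e-+ = proj₁ (proj₂ (proj₂ (proj₂ e-hom)))

  e-zero : e A.zero ≡ zero
  e-zero = proj₂ (proj₂ (proj₂ (proj₂ e-hom)))

  e-≤⇔ : ∀ {a b} → e a ≤ e b ⇔ a A.≤ b
  e-≤⇔ = IsEmbedding-≤⇔ {A} {C} e-emb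

  -- The generators e(a)·ē(b) and e(a)+ē(b) of the Δ₁-extension; complements being unique,
  -- they depend only on (a , b).
  J M : A.Carrier → A.Carrier → Carrier
  J a b = e a · compl (e b)
  M a b = e a + compl (e b)

  ≤M⇔ : ∀ {x a b} → x ≤ M a b ⇔ x · e b ≤ e a
  ≤M⇔ {b = b} = ⇔-sym (residuation (compl-isComplement (e b)))

  e≤M⇔ : ∀ {a p q} → e a ≤ M p q ⇔ a A.· q A.≤ p
  e≤M⇔ {a} {p} {q} = begin
    e a ≤ M p q          ≈⟨ ≤M⇔ ⟩
    e a · e q ≤ e p      ≡⟨ cong (_≤ e p) (e-· a q) ⟨
    e (a A.· q) ≤ e p    ≈⟨ e-≤⇔ ⟩
    a A.· q A.≤ p        ∎
    where open ⇔-Reasoning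

  J≤M⇔ : ∀ {a b p q} → J a b ≤ M p q ⇔ a A.· q A.≤ p A.+ b
  J≤M⇔ {a} {b} {p} {q} = begin
    J a b ≤ M p q                      ≈⟨ ≤M⇔ ⟩
    J a b · e q ≤ e p                  ≡⟨ cong (_≤ e p) (·-swapʳ (e a) (compl (e b)) (e q)) ⟩
    (e a · e q) · compl (e b) ≤ e p    ≈⟨ residuation (IsComplement-sym (compl-isComplement (e b))) ⟩
    e a · e q ≤ e p + e b              ≡⟨ cong₂ _≤_ (e-· a q) (e-+ p b) ⟨
    e (a A.· q) ≤ e (p A.+ b)          ≈⟨ e-≤⇔ ⟩
    a A.· q A.≤ p A.+ b                ∎
    where open ⇔-Reasoning

  J-generator : ∀ {a b d} → IsComplement C (e b) d → e a · d ≡ J a b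
  J-generator {a} {b} c = cong (e a ·_) (complement-unique c (compl-isComplement (e b)))

  M-generator : ∀ {a b d} → IsComplement C (e b) d → e a + d ≡ M a b
  M-generator {a} {b} c = cong (e a +_) (complement-unique c (compl-isComplement (e b)))

  ≤-byJ : ∀ {x z} → (∀ a b → J a b ≤ x → J a b ≤ z) → x ≤ z
  ≤-byJ {x} {z} H = proj₂ (proj₁ (proj₂ ext) x) z λ where
    _ ((a , b , d , c , refl) , Jx) →
      subst (_≤ z) (sym (J-generator c)) (H a b (subst (_≤ x) (J-generator c) Jx))

  ≤-byM : ∀ {x z} → (∀ a b → z ≤ M a b → x ≤ M a b) → x ≤ z
  ≤-byM {x} {z} H = proj₂ (proj₂ (proj₂ ext) z) x λ where
    _ ((a , b , d , c , refl) , zM) →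
      subst (x ≤_) (sym (M-generator c)) (H a b (subst (z ≤_) (M-generator c) zM))

  ≡-byM : ∀ {x y} → (∀ a b → x ≤ M a b ⇔ y ≤ M a b) → x ≡ y
  ≡-byM H = antisym (≤-byM λ a b → from (H a b)) (≤-byM λ a b → to (H a b))

  ≡-byJ : ∀ {x y} → (∀ a b → J a b ≤ x ⇔ J a b ≤ y) → x ≡ y
  ≡-byJ H = antisym (≤-byJ λ a b → to (H a b)) (≤-byJ λ a b → from (H a b))

  J-· : ∀ a b a' b' → J a b · J a' b' ≡ J (a A.· a') (b A.+ b')
  J-· a b a' b' = trans (·-interchange (e a) (compl (e b)) (e a') (compl (e b')))
    (cong₂ _·_ (sym (e-· a a')) (complement-unique complement (compl-isComplement _)))
    where
    complement : IsComplement C (e (b A.+ b')) (compl (e b) · compl (e b'))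
    complement = subst (λ t → IsComplement C t (compl (e b) · compl (e b'))) (sym (e-+ b b'))
      (complement-+ (compl-isComplement (e b)) (compl-isComplement (e b')))

  M-+ : ∀ a b a' b' → M a b + M a' b' ≡ M (a A.+ a') (b A.· b')
  M-+ a b a' b' = trans (+-interchange (e a) (compl (e b)) (e a') (compl (e b')))
    (cong₂ _+_ (sym (e-+ a a')) (complement-unique complement (compl-isComplement _)))
    where
    complement : IsComplement C (e (b A.· b')) (compl (e b) + compl (e b'))
    complement = subst (λ t → IsComplement C t (compl (e b) + compl (e b'))) (sym (e-· b b'))
      (complement-· (compl-isComplement (e b)) (compl-isComplement (e b')))

  ·-≤-byJˡ : ∀ {x y z} → (∀ a b → J a b ≤ x → J a b · y ≤ z) → x · y ≤ z
  ·-≤-byJˡ {y = y} H = from (residuation (compl-isComplement y))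
    (≤-byJ λ a b Jx → to (residuation (compl-isComplement y)) (H a b Jx))

  ·-≤-byJ : ∀ {x y z} → (∀ a b a' b' → J a b ≤ x → J a' b' ≤ y → J a b · J a' b' ≤ z) → x · y ≤ z
  ·-≤-byJ {y = y} {z} H = ·-≤-byJˡ λ a b Jx → subst (_≤ z) (·-comm y (J a b))
    (·-≤-byJˡ λ a' b' Jy → subst (_≤ z) (·-comm (J a b) (J a' b')) (H a b a' b' Jx Jy))

  +-≥-byMˡ : ∀ {x y z} → (∀ a b → x ≤ M a b → z ≤ M a b + y) → z ≤ x + y
  +-≥-byMˡ {y = y} H = to (residuation ȳ-complement)
    (≤-byM λ a b xM → from (residuation ȳ-complement) (H a b xM))
    where
    ȳ-complement : IsComplement C (compl y) y
    ȳ-complement = IsComplement-sym (compl-isComplement y)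

  +-≥-byM : ∀ {x y z} → (∀ a b a' b' → x ≤ M a b → y ≤ M a' b' → z ≤ M a b + M a' b') → z ≤ x + y
  +-≥-byM {y = y} {z} H = +-≥-byMˡ λ a b xM → subst (z ≤_) (+-comm y (M a b))
    (+-≥-byMˡ λ a' b' yM → subst (z ≤_) (+-comm (M a b) (M a' b')) (H a b a' b' xM yM))

  ·≤M⇔ : ∀ {x y p q} → x · y ≤ M p q
       ⇔ (∀ a b a' b' → J a b ≤ x → J a' b' ≤ y → (a A.· a') A.· q A.≤ p A.+ (b A.+ b'))
  ·≤M⇔ {x} {y} {p} {q} = mk⇔
    (λ xy≤M a b a' b' Jx Jy → to J≤M⇔ (subst (_≤ M p q) (J-· a b a' b') (≤-trans (·-mono Jx Jy) xy≤M)))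
    (λ H → ·-≤-byJ λ a b a' b' Jx Jy → subst (_≤ M p q) (sym (J-· a b a' b')) (from J≤M⇔ (H a b a' b' Jx Jy)))

  J≤+⇔ : ∀ {x y p q} → J p q ≤ x + y
       ⇔ (∀ a b a' b' → x ≤ M a b → y ≤ M a' b' → p A.· (b A.· b') A.≤ (a A.+ a') A.+ q)
  J≤+⇔ {x} {y} {p} {q} = mk⇔
    (λ J≤x+y a b a' b' xM yM → to J≤M⇔ (subst (J p q ≤_) (M-+ a b a' b') (≤-trans J≤x+y (+-mono xM yM))))
    (λ H → +-≥-byM λ a b a' b' xM yM → subst (J p q ≤_) (sym (M-+ a b a' b')) (from J≤M⇔ (H a b a' b' xM yM)))

premises-cong : ∀ {X : Set} {U U' V V' : X → X → Set} {P : X → X → X → X → Set}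
              → (∀ a b → U a b ⇔ U' a b) → (∀ a b → V a b ⇔ V' a b)
              → (∀ a b a' b' → U a b → V a' b' → P a b a' b')
              ⇔ (∀ a b a' b' → U' a b → V' a' b' → P a b a' b')
premises-cong U⇔U' V⇔V' = mk⇔
  (λ H a b a' b' u v → H a b a' b' (from (U⇔U' a b) u) (from (V⇔V' a' b') v))
  (λ H a b a' b' u v → H a b a' b' (to (U⇔U' a b) u) (to (V⇔V' a' b') v))

module Extension (A C₁ C₂ : CommBimonoid)
    (e₁ : CommBimonoid.Carrier A → CommBimonoid.Carrier C₁) (ext₁ : IsΔ₁Extension A C₁ e₁)
    (complemented₁ : Complemented C₁)
    (e₂ : CommBimonoid.Carrier A → CommBimonoid.Carrier C₂) (ext₂ : IsΔ₁Extension A C₂ e₂)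
    (complemented₂ : Complemented C₂) (complete₂ : Complete C₂) where
  private module A = CommBimonoid A
  module C₁ = Completion A C₁ e₁ ext₁ complemented₁
  module C₂ = Completion A C₂ e₂ ext₂ complemented₂

  φ : C₁.Carrier → C₂.Carrier
  φ x = proj₁ (complete₂ λ y → ∃[ a ] ∃[ b ] (y ≡ C₂.J a b × C₁.J a b C₁.≤ x))

  J≤φ : ∀ {a b x} → C₁.J a b C₁.≤ x → C₂.J a b C₂.≤ φ x
  J≤φ {a} {b} {x} Jx = proj₁ (proj₂ (complete₂ _)) (C₂.J a b) (a , b , refl , Jx)

  φ-least : ∀ {x u} → (∀ a b → C₁.J a b C₁.≤ x → C₂.J a b C₂.≤ u) → φ x C₂.≤ u
  φ-least {x} {u} H = proj₂ (proj₂ (complete₂ _)) u λ where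
    _ (a , b , refl , Jx) → H a b Jx

  J≤M-transfer : ∀ {a b p q} → C₁.J a b C₁.≤ C₁.M p q ⇔ C₂.J a b C₂.≤ C₂.M p q
  J≤M-transfer = ⇔-trans C₁.J≤M⇔ (⇔-sym C₂.J≤M⇔)

  ≤M⇔φ≤M : ∀ {x p q} → x C₁.≤ C₁.M p q ⇔ φ x C₂.≤ C₂.M p q
  ≤M⇔φ≤M = mk⇔
    (λ x≤M → φ-least λ a b Jx → to J≤M-transfer (C₁.≤-trans Jx x≤M))
    (λ φx≤M → C₁.≤-byJ λ a b Jx → from J≤M-transfer (C₂.≤-trans (J≤φ Jx) φx≤M))

  J≤⇔J≤φ : ∀ {a b x} → C₁.J a b C₁.≤ x ⇔ C₂.J a b C₂.≤ φ x
  J≤⇔J≤φ = mk⇔ J≤φ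
    (λ J≤φx → C₁.≤-byM λ p q x≤M → from J≤M-transfer (C₂.≤-trans J≤φx (to ≤M⇔φ≤M x≤M)))

  φ-≤⇔ : ∀ {x y} → x C₁.≤ y ⇔ φ x C₂.≤ φ y
  φ-≤⇔ = mk⇔
    (λ x≤y → C₂.≤-byM λ p q φy≤M → to ≤M⇔φ≤M (C₁.≤-trans x≤y (from ≤M⇔φ≤M φy≤M)))
    (λ φx≤φy → C₁.≤-byM λ p q y≤M → from ≤M⇔φ≤M (C₂.≤-trans φx≤φy (to ≤M⇔φ≤M y≤M)))

  φ-e : ∀ a → φ (e₁ a) ≡ e₂ a
  φ-e a = C₂.≡-byM λ p q → ⇔-trans (⇔-sym ≤M⇔φ≤M) (⇔-trans C₁.e≤M⇔ (⇔-sym C₂.e≤M⇔))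

  φ-· : ∀ x y → φ (x C₁.· y) ≡ φ x C₂.· φ y
  φ-· x y = C₂.≡-byM λ p q → begin
    φ (x C₁.· y) C₂.≤ C₂.M p q                                            ≈⟨ ≤M⇔φ≤M ⟨
    x C₁.· y C₁.≤ C₁.M p q                                                ≈⟨ C₁.·≤M⇔ ⟩
    (∀ a b a' b' → C₁.J a b C₁.≤ x → C₁.J a' b' C₁.≤ y → (a A.· a') A.· q A.≤ p A.+ (b A.+ b'))
                                                     ≈⟨ premises-cong (λ _ _ → J≤⇔J≤φ) (λ _ _ → J≤⇔J≤φ) ⟩
    (∀ a b a' b' → C₂.J a b C₂.≤ φ x → C₂.J a' b' C₂.≤ φ y → (a A.· a') A.· q A.≤ p A.+ (b A.+ b'))
                                                                          ≈⟨ C₂.·≤M⇔ ⟨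
    φ x C₂.· φ y C₂.≤ C₂.M p q                                            ∎
    where open ⇔-Reasoning

  φ-+ : ∀ x y → φ (x C₁.+ y) ≡ φ x C₂.+ φ y
  φ-+ x y = C₂.≡-byJ λ p q → begin
    C₂.J p q C₂.≤ φ (x C₁.+ y)                                            ≈⟨ J≤⇔J≤φ ⟨
    C₁.J p q C₁.≤ x C₁.+ y                                                ≈⟨ C₁.J≤+⇔ ⟩
    (∀ a b a' b' → x C₁.≤ C₁.M a b → y C₁.≤ C₁.M a' b' → p A.· (b A.· b') A.≤ (a A.+ a') A.+ q)
                                                     ≈⟨ premises-cong (λ _ _ → ≤M⇔φ≤M) (λ _ _ → ≤M⇔φ≤M) ⟩
    (∀ a b a' b' → φ x C₂.≤ C₂.M a b → φ y C₂.≤ C₂.M a' b' → p A.· (b A.· b') A.≤ (a A.+ a') A.+ q)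
                                                                          ≈⟨ C₂.J≤+⇔ ⟨
    C₂.J p q C₂.≤ φ x C₂.+ φ y                                            ∎
    where open ⇔-Reasoning

  φ-isHom : IsHom C₁ C₂ φ
  φ-isHom =
    to φ-≤⇔ , φ-· ,
    trans (cong φ (sym C₁.e-one)) (trans (φ-e A.one) C₂.e-one) , φ-+ ,
    trans (cong φ (sym C₁.e-zero)) (trans (φ-e A.zero) C₂.e-zero)

  φ-unique : (g : C₁.Carrier → C₂.Carrier) → IsEmbedding C₁ C₂ g → (∀ a → g (e₁ a) ≡ e₂ a)
           → ∀ x → g x ≡ φ x
  φ-unique g g-emb@((_ , g-· , _) , _) g-e x = C₂.≡-byM λ p q → begin
    g x C₂.≤ C₂.M p q                          ≈⟨ C₂.≤M⇔ ⟩
    g x C₂.· e₂ q C₂.≤ e₂ p                    ≡⟨ cong₂ (λ s t → g x C₂.· s C₂.≤ t) (g-e q) (g-e p) ⟨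
    g x C₂.· g (e₁ q) C₂.≤ g (e₁ p)            ≡⟨ cong (C₂._≤ g (e₁ p)) (g-· x (e₁ q)) ⟨
    g (x C₁.· e₁ q) C₂.≤ g (e₁ p)              ≈⟨ IsEmbedding-≤⇔ {C₁} {C₂} g-emb ⟩
    x C₁.· e₁ q C₁.≤ e₁ p                      ≈⟨ C₁.≤M⇔ ⟨
    x C₁.≤ C₁.M p q                            ≈⟨ ≤M⇔φ≤M ⟩
    φ x C₂.≤ C₂.M p q                          ∎
    where open ⇔-Reasoning

DM-completion-unique :
    (A C₁ C₂ : CommBimonoid)
  → (e₁ : CommBimonoid.Carrier A → CommBimonoid.Carrier C₁) → IsComplementedDMCompletion A C₁ e₁
  → (e₂ : CommBimonoid.Carrier A → CommBimonoid.Carrier C₂) → IsComplementedDMCompletion A C₂ e₂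
  → Σ (CommBimonoid.Carrier C₁ → CommBimonoid.Carrier C₂) λ φ →
      (IsIso C₁ C₂ φ × (∀ a → φ (e₁ a) ≡ e₂ a))
      × (∀ g → IsIso C₁ C₂ g → (∀ a → g (e₁ a) ≡ e₂ a) → ∀ x → g x ≡ φ x)
DM-completion-unique A C₁ C₂ e₁ (ext₁ , complete₁ , complemented₁) e₂ (ext₂ , complete₂ , complemented₂) =
  F.φ , ((F.φ-isHom , G.φ , G∘F , F∘G , to G.φ-≤⇔) , F.φ-e) ,
  λ g g-iso → F.φ-unique g (IsIso⇒IsEmbedding {C₁} {C₂} g-iso)
  where
  module F = Extension A C₁ C₂ e₁ ext₁ complemented₁ e₂ ext₂ complemented₂ complete₂
  module G = Extension A C₂ C₁ e₂ ext₂ complemented₂ e₁ ext₁ complemented₁ complete₁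

  G∘F : ∀ x → G.φ (F.φ x) ≡ x
  G∘F x = F.C₁.≡-byM λ p q → ⇔-trans (⇔-sym G.≤M⇔φ≤M) (⇔-sym F.≤M⇔φ≤M)

  F∘G : ∀ y → F.φ (G.φ y) ≡ y
  F∘G y = F.C₂.≡-byM λ p q → ⇔-trans (⇔-sym F.≤M⇔φ≤M) (⇔-sym G.≤M⇔φ≤M)

mainTheorem6 : (A B AΔ BΔ : CommBimonoid)
    → (ι : CommBimonoid.Carrier A → CommBimonoid.Carrier B)
    → IsIso A B ι
    → (eA : CommBimonoid.Carrier A → CommBimonoid.Carrier AΔ)
    → IsComplementedDMCompletion A AΔ eA
    → (eB : CommBimonoid.Carrier B → CommBimonoid.Carrier BΔ)
    → IsComplementedDMCompletion B BΔ eB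
    → Σ (CommBimonoid.Carrier AΔ → CommBimonoid.Carrier BΔ) (λ ιΔ →
        (IsIso AΔ BΔ ιΔ × (∀ a → ιΔ (eA a) ≡ eB (ι a)))
        × (∀ (g : CommBimonoid.Carrier AΔ → CommBimonoid.Carrier BΔ)
             → IsIso AΔ BΔ g
             → (∀ a → g (eA a) ≡ eB (ι a))
             → ∀ x → g x ≡ ιΔ x))
mainTheorem6 A B AΔ BΔ ι ι-iso eA eA-completion eB (eB-ext , BΔ-complete , BΔ-complemented) =
  DM-completion-unique A AΔ BΔ eA eA-completion (eB ∘ ι)
    (IsΔ₁Extension-∘-iso {A} {B} {BΔ} ι-iso eB-ext , BΔ-complete , BΔ-complemented)
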